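{- For every integer $n\ge 1$, $$R_n:=\sum_{b=0}^{2^n-1}\left(T^1_n(b)-\frac{3^{M_{n-1}(b)}}{2^n}\,b\right)=2^{n-2}\,n.$$
   Context: Let $T^1:\mathbb{N}\to\mathbb{N}$ be the Collatz function, $T^1(N)=N/2$ if $N$ is even and $T^1(N)=\frac{3N+1}{2}$ if $N$ is odd; in particular $T^1(0)=0$. Write $T^1_k$ for the $k$-th iterate of $T^1$, with $T^1_0$ the identity. For an integer $n\ge1$ and $b\in\{0,1,\dots,2^n-1\}$, let $M_{n-1}(b)$ be the number of odd integers among the $n$ terms $b, T^1_1(b),\dots,T^1_{n-1}(b)$. In particular $M_{n-1}(0)=0$ and $T^1_n(0)=0$. For each such $b$, the summand $B_{n}(b)=T^1_n(b)-\frac{3^{M_{n-1}(b)}}{2^n}b$ is the constant term in the affine expression $T^1_n(P)=\frac{3^{M_{n-1}(b)}}{2^n}P+B_n(b)$, valid for all positive integers $P\equiv b\pmod{2^n}$. -}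

module Defs where

open import Data.Nat using (ℕ; zero; suc; _+_; _*_; _^_)
open import Data.Nat.DivMod using (_/_)
open import Data.Bool using (Bool; true; false; if_then_else_)
open import Data.Nat.DivMod using (_%_)
open import Data.Integer using (+_)
open import Data.Nat.Properties using (m^n≢0)
open import Data.List using (List; foldr; map; upTo)
import Data.Rational as ℚ
open ℚ using (ℚ)

isEven : ℕ → Bool
isEven N with N % 2
... | zero = true
... | suc _ = false

T¹ : ℕ → ℕ
T¹ N = if isEven N then N / 2 else (3 * N + 1) / 2

T¹^ : ℕ → ℕ → ℕ
T¹^ zero    N = N
T¹^ (suc k) N = T¹^ k (T¹ N)

oddCount : ℕ → ℕ → ℕ
oddCount zero    b = 0
oddCount (suc m) b = (if isEven b then 0 else 1) + oddCount m (T¹ b)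

-- M_{n-1}(b): number of odd integers among the n terms b, T¹_1 b, …, T¹_{n-1} b
M : ℕ → ℕ → ℕ
M n b = oddCount n b

B : ℕ → ℕ → ℚ
B n b = ((+ T¹^ n b) ℚ./ 1) ℚ.- ((+ ((3 ^ M n b) * b)) ℚ./ (2 ^ n)) {{m^n≢0 2 n}}

R : ℕ → ℚ
R n = foldr ℚ._+_ ℚ.0ℚ (map (B n) (upTo (2 ^ n)))

-- Scaled by 2ⁿ, the summand becomes the natural number cₙ(b) = 2ⁿ T¹ₙ(b) − 3^{Mₙ₋₁(b)} b,
-- which depends only on b mod 2ⁿ and, reading the last Collatz step off the affine
-- formula 2 T¹(z) = 3^p z + p (p the parity of z), satisfies c_{n+1}(b) = 3^e cₙ(b) + 2ⁿ e
-- with e the parity of T¹ₙ(b). The residues b and b + 2ⁿ agree for n steps, after which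
-- their iterates differ by the odd number 3^{Mₙ₋₁(b)}; so their last parities are 0 and 1
-- in some order and c_{n+1}(b) + c_{n+1}(b + 2ⁿ) = 4 cₙ(b) + 2ⁿ. Summing over b gives
-- C_{n+1} = 4 Cₙ + 4ⁿ for Cₙ = Σ_b cₙ(b), hence Cₙ = n 4ⁿ / 4 and Rₙ = Cₙ / 2ⁿ = n 2ⁿ / 4.
module Submission where

open import Defs
open import Data.Nat using (ℕ; zero; suc; _+_; _*_; _^_; _≥_; NonZero)
open import Data.Nat.Properties
open import Data.Nat.DivMod using (_%_; _/_; m*n%n≡0; [m+kn]%n≡m%n; m*n/n≡m)
import Data.Nat.Tactic.RingSolver as ℕ-Solver
open import Algebra.Properties.CommutativeSemigroup *-commutativeSemigroup
  using (x∙yz≈y∙xz; xy∙z≈y∙xz)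
open import Data.Bool using (true; false; if_then_else_)
open import Data.Product using (∃-syntax; _,_)
open import Data.Sum using (_⊎_; inj₁; inj₂)
open import Data.List using (foldr; applyUpTo)
open import Data.List.Properties using (map-upTo)
open import Function using (_∘_)
open import Relation.Binary.PropositionalEquality
open ≡-Reasoning
import Data.Integer as ℤ
import Data.Integer.Properties as ℤ
import Data.Integer.Tactic.RingSolver as ℤ-Solver
import Data.Rational as ℚ
import Data.Rational.Properties as ℚ
open import Data.Rational.Unnormalised using (mkℚᵘ; *≡*)
import Data.Rational.Unnormalised.Properties as ℚᵘ
open import Algebra.Properties.Group ℚ.+-0-group using (quasigroup)
open import Algebra.Properties.Quasigroup quasigroup using (x≈z//y)

parity : ℕ → ℕ
parity b = if isEven b then 0 else 1

isEven-true : ∀ N → N % 2 ≡ 0 → isEven N ≡ true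
isEven-true N eq with N % 2
... | zero = refl

isEven-false : ∀ N → N % 2 ≡ 1 → isEven N ≡ false
isEven-false N eq with N % 2
... | suc zero = refl

isEven-2* : ∀ k → isEven (2 * k) ≡ true
isEven-2* k = isEven-true (2 * k) (trans (cong (_% 2) (*-comm 2 k)) (m*n%n≡0 k 2))

isEven-1+2* : ∀ k → isEven (1 + 2 * k) ≡ false
isEven-1+2* k = isEven-false (1 + 2 * k)
  (trans (cong (λ m → (1 + m) % 2) (*-comm 2 k)) ([m+kn]%n≡m%n 1 k 2))

parity-2* : ∀ k → parity (2 * k) ≡ 0
parity-2* k rewrite isEven-2* k = refl

parity-1+2* : ∀ k → parity (1 + 2 * k) ≡ 1
parity-1+2* k rewrite isEven-1+2* k = refl

T¹-2* : ∀ k → T¹ (2 * k) ≡ k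
T¹-2* k rewrite isEven-2* k = trans (cong (_/ 2) (*-comm 2 k)) (m*n/n≡m k 2)

T¹-1+2* : ∀ k → T¹ (1 + 2 * k) ≡ 2 + 3 * k
T¹-1+2* k rewrite isEven-1+2* k = trans (cong (_/ 2) (step k)) (m*n/n≡m (2 + 3 * k) 2)
  where
  step : ∀ k → 3 * (1 + 2 * k) + 1 ≡ (2 + 3 * k) * 2
  step = ℕ-Solver.solve-∀

even⊎odd : ∀ b → (∃[ k ] b ≡ 2 * k) ⊎ (∃[ k ] b ≡ 1 + 2 * k)
even⊎odd zero = inj₁ (0 , refl)
even⊎odd (suc b) with even⊎odd b
... | inj₁ (k , refl) = inj₂ (k , refl)
... | inj₂ (k , refl) = inj₁ (suc k , sym (*-suc 2 k))

2*T¹ : ∀ b → 2 * T¹ b ≡ 3 ^ parity b * b + parity b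
2*T¹ b with even⊎odd b
... | inj₁ (k , refl) rewrite T¹-2* k | parity-2* k = even-case k
  where
  even-case : ∀ k → 2 * k ≡ 1 * (2 * k) + 0
  even-case = ℕ-Solver.solve-∀
... | inj₂ (k , refl) rewrite T¹-1+2* k | parity-1+2* k = odd-case k
  where
  odd-case : ∀ k → 2 * (2 + 3 * k) ≡ 3 * (1 + 2 * k) + 1
  odd-case = ℕ-Solver.solve-∀

parity-+-2* : ∀ x m → parity (x + 2 * m) ≡ parity x
parity-+-2* x m with even⊎odd x
... | inj₁ (k , refl) =
  trans (cong parity (sym (*-distribˡ-+ 2 k m))) (trans (parity-2* (k + m)) (sym (parity-2* k)))
... | inj₂ (k , refl) =
  trans (cong (parity ∘ suc) (sym (*-distribˡ-+ 2 k m))) (trans (parity-1+2* (k + m)) (sym (parity-1+2* k)))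

T¹-+-2* : ∀ x m → T¹ (x + 2 * m) ≡ T¹ x + 3 ^ parity x * m
T¹-+-2* x m = *-cancelˡ-≡ _ _ 2 (begin
  2 * T¹ (x + 2 * m)                                         ≡⟨ 2*T¹ (x + 2 * m) ⟩
  3 ^ parity (x + 2 * m) * (x + 2 * m) + parity (x + 2 * m) ≡⟨ cong (λ q → 3 ^ q * (x + 2 * m) + q) (parity-+-2* x m) ⟩
  3 ^ p * (x + 2 * m) + p                                    ≡⟨ regroup (3 ^ p) x m p ⟩
  (3 ^ p * x + p) + 2 * (3 ^ p * m)                          ≡⟨ cong (_+ 2 * (3 ^ p * m)) (2*T¹ x) ⟨
  2 * T¹ x + 2 * (3 ^ p * m)                                 ≡⟨ *-distribˡ-+ 2 (T¹ x) _ ⟨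
  2 * (T¹ x + 3 ^ p * m)                                     ∎)
  where
  p = parity x
  regroup : ∀ a x m p → a * (x + 2 * m) + p ≡ (a * x + p) + 2 * (a * m)
  regroup = ℕ-Solver.solve-∀

parity-suc : ∀ x → parity x + parity (suc x) ≡ 1
parity-suc x with even⊎odd x
... | inj₁ (k , refl) = cong₂ _+_ (parity-2* k) (parity-1+2* k)
... | inj₂ (k , refl) = cong₂ _+_ (parity-1+2* k) (trans (cong parity (sym (*-suc 2 k))) (parity-2* (suc k)))

3^-odd : ∀ m → ∃[ j ] 3 ^ m ≡ 1 + 2 * j
3^-odd zero = 0 , refl
3^-odd (suc m) with 3^-odd m
... | j , 3^m≡1+2j = 1 + 3 * j , trans (cong (3 *_) 3^m≡1+2j) (step j)
  where
  step : ∀ j → 3 * (1 + 2 * j) ≡ 1 + 2 * (1 + 3 * j)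
  step = ℕ-Solver.solve-∀

parity-+-3^ : ∀ x m → parity x + parity (x + 3 ^ m) ≡ 1
parity-+-3^ x m with 3^-odd m
... | j , 3^m≡1+2j = begin
  parity x + parity (x + 3 ^ m)       ≡⟨ cong (λ y → parity x + parity (x + y)) 3^m≡1+2j ⟩
  parity x + parity (x + suc (2 * j)) ≡⟨ cong (λ y → parity x + parity y) (+-suc x (2 * j)) ⟩
  parity x + parity (suc x + 2 * j)   ≡⟨ cong (parity x +_) (parity-+-2* (suc x) j) ⟩
  parity x + parity (suc x)           ≡⟨ parity-suc x ⟩
  1                                   ∎

T¹-+-2^suc* : ∀ n x t → T¹ (x + 2 ^ suc n * t) ≡ T¹ x + 2 ^ n * (3 ^ parity x * t)
T¹-+-2^suc* n x t = begin
  T¹ (x + 2 * 2 ^ n * t)       ≡⟨ cong (T¹ ∘ (x +_)) (*-assoc 2 (2 ^ n) t) ⟩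
  T¹ (x + 2 * (2 ^ n * t))     ≡⟨ T¹-+-2* x (2 ^ n * t) ⟩
  T¹ x + 3 ^ p * (2 ^ n * t)   ≡⟨ cong (T¹ x +_) (x∙yz≈y∙xz (3 ^ p) (2 ^ n) t) ⟩
  T¹ x + 2 ^ n * (3 ^ p * t)   ∎
  where p = parity x

parity-+-2^suc* : ∀ n x t → parity (x + 2 ^ suc n * t) ≡ parity x
parity-+-2^suc* n x t = trans (cong (parity ∘ (x +_)) (*-assoc 2 (2 ^ n) t)) (parity-+-2* x (2 ^ n * t))

M-shift : ∀ n x t → M n (x + 2 ^ n * t) ≡ M n x
M-shift zero x t = refl
M-shift (suc n) x t = cong₂ _+_ (parity-+-2^suc* n x t)
  (trans (cong (M n) (T¹-+-2^suc* n x t)) (M-shift n (T¹ x) _))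

m^a*[m^b*t]≡m^[b+a]*t : ∀ m a b t → m ^ a * (m ^ b * t) ≡ m ^ (b + a) * t
m^a*[m^b*t]≡m^[b+a]*t m a b t = begin
  m ^ a * (m ^ b * t) ≡⟨ x∙yz≈y∙xz (m ^ a) (m ^ b) t ⟩
  m ^ b * (m ^ a * t) ≡⟨ *-assoc (m ^ b) (m ^ a) t ⟨
  m ^ b * m ^ a * t   ≡⟨ cong (_* t) (^-distribˡ-+-* m b a) ⟨
  m ^ (b + a) * t     ∎

T¹^-shift : ∀ n x t → T¹^ n (x + 2 ^ n * t) ≡ T¹^ n x + 3 ^ M n x * t
T¹^-shift zero x t = refl
T¹^-shift (suc n) x t = begin
  T¹^ n (T¹ (x + 2 ^ suc n * t))               ≡⟨ cong (T¹^ n) (T¹-+-2^suc* n x t) ⟩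
  T¹^ n (T¹ x + 2 ^ n * (3 ^ p * t))           ≡⟨ T¹^-shift n (T¹ x) (3 ^ p * t) ⟩
  T¹^ n (T¹ x) + 3 ^ M n (T¹ x) * (3 ^ p * t)  ≡⟨ cong (T¹^ n (T¹ x) +_) (m^a*[m^b*t]≡m^[b+a]*t 3 _ p t) ⟩
  T¹^ n (T¹ x) + 3 ^ (p + M n (T¹ x)) * t      ∎
  where p = parity x

T¹^-suc : ∀ n b → T¹^ (suc n) b ≡ T¹ (T¹^ n b)
T¹^-suc zero b = refl
T¹^-suc (suc n) b = T¹^-suc n (T¹ b)

M-suc : ∀ n b → M (suc n) b ≡ M n b + parity (T¹^ n b)
M-suc zero b = +-identityʳ (parity b)
M-suc (suc n) b = trans (cong (parity b +_) (M-suc n (T¹ b))) (sym (+-assoc (parity b) _ _))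

-- scaledB n b = 2ⁿ Bₙ(b) (see T¹^-affine), accumulated from the last Collatz step backwards.
scaledB : ℕ → ℕ → ℕ
scaledB zero    b = 0
scaledB (suc n) b = 3 ^ e * scaledB n b + 2 ^ n * e
  where e = parity (T¹^ n b)

T¹^-affine : ∀ n b → 2 ^ n * T¹^ n b ≡ 3 ^ M n b * b + scaledB n b
T¹^-affine zero b = sym (+-identityʳ (1 * b))
T¹^-affine (suc n) b = begin
  2 * 2 ^ n * T¹^ (suc n) b                          ≡⟨ cong (2 * 2 ^ n *_) (T¹^-suc n b) ⟩
  2 * 2 ^ n * T¹ z                                   ≡⟨ xy∙z≈y∙xz 2 (2 ^ n) (T¹ z) ⟩
  2 ^ n * (2 * T¹ z)                                 ≡⟨ cong (2 ^ n *_) (2*T¹ z) ⟩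
  2 ^ n * (3 ^ e * z + e)                            ≡⟨ distribute (2 ^ n) (3 ^ e) z e ⟩
  3 ^ e * (2 ^ n * z) + 2 ^ n * e                    ≡⟨ cong (λ w → 3 ^ e * w + 2 ^ n * e) (T¹^-affine n b) ⟩
  3 ^ e * (3 ^ M n b * b + scaledB n b) + 2 ^ n * e  ≡⟨ regroup (3 ^ e) (3 ^ M n b * b) (scaledB n b) (2 ^ n * e) ⟩
  3 ^ e * (3 ^ M n b * b) + scaledB (suc n) b        ≡⟨ cong (_+ scaledB (suc n) b) (m^a*[m^b*t]≡m^[b+a]*t 3 e (M n b) b) ⟩
  3 ^ (M n b + e) * b + scaledB (suc n) b            ≡⟨ cong (λ m → 3 ^ m * b + scaledB (suc n) b) (M-suc n b) ⟨
  3 ^ M (suc n) b * b + scaledB (suc n) b            ∎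
  where
  z = T¹^ n b
  e = parity z
  distribute : ∀ q a z e → q * (a * z + e) ≡ a * (q * z) + q * e
  distribute = ℕ-Solver.solve-∀
  regroup : ∀ a y s r → a * (y + s) + r ≡ a * y + (a * s + r)
  regroup = ℕ-Solver.solve-∀

scaledB-shift : ∀ n x t → scaledB n (x + 2 ^ n * t) ≡ scaledB n x
scaledB-shift n x t = +-cancelˡ-≡ (3 ^ M n x * y) _ _ (begin
  3 ^ M n x * y + scaledB n y                         ≡⟨ cong (λ m → 3 ^ m * y + scaledB n y) (M-shift n x t) ⟨
  3 ^ M n y * y + scaledB n y                         ≡⟨ T¹^-affine n y ⟨
  2 ^ n * T¹^ n y                                     ≡⟨ cong (2 ^ n *_) (T¹^-shift n x t) ⟩
  2 ^ n * (T¹^ n x + 3 ^ M n x * t)                   ≡⟨ *-distribˡ-+ (2 ^ n) (T¹^ n x) _ ⟩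
  2 ^ n * T¹^ n x + 2 ^ n * (3 ^ M n x * t)           ≡⟨ cong (_+ 2 ^ n * (3 ^ M n x * t)) (T¹^-affine n x) ⟩
  3 ^ M n x * x + scaledB n x + 2 ^ n * (3 ^ M n x * t) ≡⟨ regroup (3 ^ M n x) x (scaledB n x) (2 ^ n) t ⟩
  3 ^ M n x * y + scaledB n x                         ∎)
  where
  y = x + 2 ^ n * t
  regroup : ∀ a x s q t → a * x + s + q * (a * t) ≡ a * (x + q * t) + s
  regroup = ℕ-Solver.solve-∀

pair-sum : ∀ c q e₀ e₁ → e₀ + e₁ ≡ 1 → (3 ^ e₀ * c + q * e₀) + (3 ^ e₁ * c + q * e₁) ≡ 4 * c + q
pair-sum c q 0 .1 refl = 0,1-case c q
  where
  0,1-case : ∀ c q → 1 * c + q * 0 + (3 * c + q * 1) ≡ 4 * c + q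
  0,1-case = ℕ-Solver.solve-∀
pair-sum c q 1 .0 refl = 1,0-case c q
  where
  1,0-case : ∀ c q → 3 * c + q * 1 + (1 * c + q * 0) ≡ 4 * c + q
  1,0-case = ℕ-Solver.solve-∀

scaledB-pair : ∀ n x → scaledB (suc n) x + scaledB (suc n) (2 ^ n + x) ≡ 4 * scaledB n x + 2 ^ n
scaledB-pair n x = begin
  scaledB (suc n) x + (3 ^ e₁ * scaledB n y + 2 ^ n * e₁)
    ≡⟨ cong (λ s → scaledB (suc n) x + (3 ^ e₁ * s + 2 ^ n * e₁)) (trans (cong (scaledB n) y≡) (scaledB-shift n x 1)) ⟩
  (3 ^ e₀ * scaledB n x + 2 ^ n * e₀) + (3 ^ e₁ * scaledB n x + 2 ^ n * e₁)
    ≡⟨ pair-sum (scaledB n x) (2 ^ n) e₀ e₁ e₀+e₁≡1 ⟩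
  4 * scaledB n x + 2 ^ n ∎
  where
  y = 2 ^ n + x
  e₀ = parity (T¹^ n x)
  e₁ = parity (T¹^ n y)
  y≡ : y ≡ x + 2 ^ n * 1
  y≡ = trans (+-comm (2 ^ n) x) (cong (x +_) (sym (*-identityʳ (2 ^ n))))
  T¹^y≡ : T¹^ n y ≡ T¹^ n x + 3 ^ M n x
  T¹^y≡ = trans (cong (T¹^ n) y≡) (trans (T¹^-shift n x 1) (cong (T¹^ n x +_) (*-identityʳ _)))
  e₀+e₁≡1 : e₀ + e₁ ≡ 1
  e₀+e₁≡1 = trans (cong (λ z → e₀ + parity z) T¹^y≡) (parity-+-3^ (T¹^ n x) (M n x))

∑< : ℕ → (ℕ → ℕ) → ℕ
∑< zero    f = 0
∑< (suc k) f = f 0 + ∑< k (f ∘ suc)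

∑<-cong : ∀ k {f g} → (∀ x → f x ≡ g x) → ∑< k f ≡ ∑< k g
∑<-cong zero    f≗g = refl
∑<-cong (suc k) f≗g = cong₂ _+_ (f≗g 0) (∑<-cong k (f≗g ∘ suc))

∑<-split : ∀ a b f → ∑< (a + b) f ≡ ∑< a f + ∑< b (λ x → f (a + x))
∑<-split zero    b f = refl
∑<-split (suc a) b f = trans (cong (f 0 +_) (∑<-split a b (f ∘ suc))) (sym (+-assoc (f 0) _ _))

∑<-+ : ∀ k f g → ∑< k (λ x → f x + g x) ≡ ∑< k f + ∑< k g
∑<-+ zero    f g = refl
∑<-+ (suc k) f g = trans (cong (f 0 + g 0 +_) (∑<-+ k (f ∘ suc) (g ∘ suc)))
  (+-assoc-middle (f 0) (g 0) (∑< k (f ∘ suc)) (∑< k (g ∘ suc)))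
  where
  +-assoc-middle : ∀ a b c d → a + b + (c + d) ≡ a + c + (b + d)
  +-assoc-middle = ℕ-Solver.solve-∀

∑<-*ˡ : ∀ k c f → ∑< k (λ x → c * f x) ≡ c * ∑< k f
∑<-*ˡ zero    c f = sym (*-zeroʳ c)
∑<-*ˡ (suc k) c f = trans (cong (c * f 0 +_) (∑<-*ˡ k c (f ∘ suc))) (sym (*-distribˡ-+ c (f 0) _))

∑<-const : ∀ k c → ∑< k (λ _ → c) ≡ k * c
∑<-const zero    c = refl
∑<-const (suc k) c = cong (c +_) (∑<-const k c)

scaledR : ℕ → ℕ
scaledR n = ∑< (2 ^ n) (scaledB n)

scaledR-suc : ∀ n → scaledR (suc n) ≡ 4 * scaledR n + 2 ^ n * 2 ^ n
scaledR-suc n = begin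
  ∑< (2 * Q) (scaledB (suc n))
    ≡⟨ cong (λ k → ∑< (Q + k) (scaledB (suc n))) (+-identityʳ Q) ⟩
  ∑< (Q + Q) (scaledB (suc n))
    ≡⟨ ∑<-split Q Q (scaledB (suc n)) ⟩
  ∑< Q (scaledB (suc n)) + ∑< Q (λ x → scaledB (suc n) (Q + x))
    ≡⟨ ∑<-+ Q (scaledB (suc n)) (λ x → scaledB (suc n) (Q + x)) ⟨
  ∑< Q (λ x → scaledB (suc n) x + scaledB (suc n) (Q + x))
    ≡⟨ ∑<-cong Q (scaledB-pair n) ⟩
  ∑< Q (λ x → 4 * scaledB n x + Q)
    ≡⟨ ∑<-+ Q (λ x → 4 * scaledB n x) (λ _ → Q) ⟩
  ∑< Q (λ x → 4 * scaledB n x) + ∑< Q (λ _ → Q)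
    ≡⟨ cong₂ _+_ (∑<-*ˡ Q 4 (scaledB n)) (∑<-const Q Q) ⟩
  4 * scaledR n + Q * Q ∎
  where Q = 2 ^ n

scaledR*4 : ∀ n → scaledR n * 4 ≡ 2 ^ n * n * 2 ^ n
scaledR*4 zero = refl
scaledR*4 (suc n) = begin
  scaledR (suc n) * 4                  ≡⟨ cong (_* 4) (scaledR-suc n) ⟩
  (4 * scaledR n + Q * Q) * 4          ≡⟨ expand (scaledR n) Q ⟩
  4 * (scaledR n * 4) + 4 * (Q * Q)    ≡⟨ cong (λ s → 4 * s + 4 * (Q * Q)) (scaledR*4 n) ⟩
  4 * (Q * n * Q) + 4 * (Q * Q)        ≡⟨ collect Q n ⟩
  2 * Q * suc n * (2 * Q)              ∎
  where
  Q = 2 ^ n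
  expand : ∀ s Q → (4 * s + Q * Q) * 4 ≡ 4 * (s * 4) + 4 * (Q * Q)
  expand = ℕ-Solver.solve-∀
  collect : ∀ Q n → 4 * (Q * n * Q) + 4 * (Q * Q) ≡ 2 * Q * suc n * (2 * Q)
  collect = ℕ-Solver.solve-∀

-- Opened only here: its prefix +_ makes the ℕ sections (x +_) above ambiguous.
open import Data.Integer using (+_)

-- For D = suc d, (+ a) ℚ./ D is by definition fromℚᵘ (mkℚᵘ (+ a) d).
/-cross : ∀ a b D E .{{_ : NonZero D}} .{{_ : NonZero E}} →
          a * E ≡ b * D → (+ a) ℚ./ D ≡ (+ b) ℚ./ E
/-cross a b (suc d) (suc e) aE≡bD =
  ℚ.fromℚᵘ-cong {mkℚᵘ (+ a) d} {mkℚᵘ (+ b) e}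
    (*≡* (trans (sym (ℤ.pos-* a (suc e))) (trans (cong +_ aE≡bD) (ℤ.pos-* b (suc d)))))

/-+ : ∀ a b D .{{_ : NonZero D}} → (+ a) ℚ./ D ℚ.+ (+ b) ℚ./ D ≡ (+ (a + b)) ℚ./ D
/-+ a b (suc d) = ℚ.toℚᵘ-injective
  (ℚᵘ.≃-trans (ℚ.toℚᵘ-homo-+ ((+ a) ℚ./ D) ((+ b) ℚ./ D))
  (ℚᵘ.≃-trans (ℚᵘ.+-cong (ℚ.toℚᵘ-fromℚᵘ (mkℚᵘ (+ a) d)) (ℚ.toℚᵘ-fromℚᵘ (mkℚᵘ (+ b) d)))
  (ℚᵘ.≃-trans (*≡* cross) (ℚᵘ.≃-sym (ℚ.toℚᵘ-fromℚᵘ (mkℚᵘ (+ (a + b)) d))))))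
  where
  D = suc d
  common : ∀ (x y z : ℤ.ℤ) → (x ℤ.* z ℤ.+ y ℤ.* z) ℤ.* z ≡ (x ℤ.+ y) ℤ.* (z ℤ.* z)
  common = ℤ-Solver.solve-∀
  cross : (+ a ℤ.* + D ℤ.+ + b ℤ.* + D) ℤ.* + D ≡ + (a + b) ℤ.* + (D * D)
  cross = trans (common (+ a) (+ b) (+ D)) (sym (cong₂ ℤ._*_ (ℤ.pos-+ a b) (ℤ.pos-* D D)))

x-y≡z : ∀ x y z → y ℚ.+ z ≡ x → x ℚ.- y ≡ z
x-y≡z x y z y+z≡x = sym (x≈z//y z y x (trans (ℚ.+-comm z y) y+z≡x))

B≡scaledB/2ⁿ : ∀ n b → B n b ≡ ((+ scaledB n b) ℚ./ 2 ^ n) {{m^n≢0 2 n}}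
B≡scaledB/2ⁿ n b = x-y≡z _ _ _ (begin
  (+ (3 ^ M n b * b)) ℚ./ 2 ^ n ℚ.+ (+ scaledB n b) ℚ./ 2 ^ n ≡⟨ /-+ (3 ^ M n b * b) (scaledB n b) (2 ^ n) ⟩
  (+ (3 ^ M n b * b + scaledB n b)) ℚ./ 2 ^ n                ≡⟨ cong (λ w → (+ w) ℚ./ 2 ^ n) (T¹^-affine n b) ⟨
  (+ (2 ^ n * T¹^ n b)) ℚ./ 2 ^ n
    ≡⟨ /-cross (2 ^ n * T¹^ n b) (T¹^ n b) (2 ^ n) 1 (trans (*-identityʳ _) (*-comm (2 ^ n) _)) ⟩
  (+ T¹^ n b) ℚ./ 1                                          ∎)
  where instance _ = m^n≢0 2 n

foldr-+-/ : ∀ D .{{_ : NonZero D}} {f : ℕ → ℚ.ℚ} (g : ℕ → ℕ) k →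
            (∀ x → f x ≡ (+ g x) ℚ./ D) → foldr ℚ._+_ ℚ.0ℚ (applyUpTo f k) ≡ (+ ∑< k g) ℚ./ D
foldr-+-/ D g zero    f≡g/D = sym (ℚ.0/n≡0 D)
foldr-+-/ D g (suc k) f≡g/D = trans (cong₂ ℚ._+_ (f≡g/D 0) (foldr-+-/ D (g ∘ suc) k (f≡g/D ∘ suc)))
  (/-+ (g 0) (∑< k (g ∘ suc)) D)

mainTheorem3 : (n : ℕ) → n ≥ 1 → R n ≡ (+ ((2 ^ n) * n)) ℚ./ 4
mainTheorem3 n _ = begin
  R n                                            ≡⟨ cong (foldr ℚ._+_ ℚ.0ℚ) (map-upTo (B n) (2 ^ n)) ⟩
  foldr ℚ._+_ ℚ.0ℚ (applyUpTo (B n) (2 ^ n))     ≡⟨ foldr-+-/ (2 ^ n) (scaledB n) (2 ^ n) (B≡scaledB/2ⁿ n) ⟩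
  (+ scaledR n) ℚ./ 2 ^ n                        ≡⟨ /-cross (scaledR n) (2 ^ n * n) (2 ^ n) 4 (scaledR*4 n) ⟩
  (+ (2 ^ n * n)) ℚ./ 4                          ∎
  where instance _ = m^n≢0 2 n
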